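{- Let $p\geq 5$ be a prime number, $N=p\prod_{\ell\in S(p)}\ell$, and let $r$ be a prime number with $r\equiv -1\pmod N$ and $r^{p-1}\not\equiv 1\pmod{p^2}$. Let $q$ be a prime number with $q\neq p$ and $q\not\equiv 1\pmod p$, and let $C_q/\mathbb{Q}$ be the curve $x^p+qy^p+rz^p=0$. Then $C_q(\mathbb{Q}_\ell)\neq\emptyset$ for every prime $\ell\neq p$.
   Context: A prime $\ell$ is called exceptional for $p$ if $\ell\neq p$ and there exist $u,v,w\in\mathbb{F}_\ell^*$ such that the curve $ux^p+vy^p+wz^p=0$ has no $\mathbb{F}_\ell$-rational points. $S(p)$ denotes the (finite) set of primes exceptional for $p$. -}

module Defs where

open import Data.Nat using (ℕ; zero; suc; _+_; _*_; _∸_; _^_; _<_)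
open import Data.Nat.Primality using (Prime)
open import Data.List using (List)
open import Data.Product using (Σ; _×_; ∃; ∃-syntax)
open import Data.Sum using (_⊎_)
open import Relation.Binary.PropositionalEquality using (_≡_)
open import Relation.Nullary using (¬_)

_≡_[mod_] : ℕ → ℕ → ℕ → Set
a ≡ b [mod m ] = Σ ℕ λ k → (a ≡ b + k * m) ⊎ (b ≡ a + k * m)

-- Exceptional primes (the set S(p)).
-- ℓ is exceptional for p if ℓ is prime, ℓ ≠ p, and there are u,v,w ∈ 𝔽_ℓ^*
-- (represented by 0 < u,v,w < ℓ) such that the projective curve
-- u x^p + v y^p + w z^p = 0 has no 𝔽_ℓ-rational point, i.e. there is no
-- (x,y,z) ∈ 𝔽_ℓ^3 ∖ {0} (represented by x,y,z < ℓ, not all 0) on it.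

NonZeroTriple : ℕ → ℕ → ℕ → Set
NonZeroTriple x y z = ¬ (x ≡ 0 × y ≡ 0 × z ≡ 0)

HasFℓPoint : (p ℓ u v w : ℕ) → Set
HasFℓPoint p ℓ u v w =
  ∃[ x ] ∃[ y ] ∃[ z ] (x < ℓ × y < ℓ × z < ℓ × NonZeroTriple x y z
    × (u * x ^ p + v * y ^ p + w * z ^ p) ≡ 0 [mod ℓ ])

Exceptional : ℕ → ℕ → Set
Exceptional p ℓ = Prime ℓ × ¬ (ℓ ≡ p) ×
  ∃[ u ] ∃[ v ] ∃[ w ] (0 < u × u < ℓ × 0 < v × v < ℓ × 0 < w × w < ℓ
    × ¬ HasFℓPoint p ℓ u v w)

-- ℓ-adic integers, as the inverse limit of ℤ/ℓ^k ℤ: a compatible sequence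
-- of residues a k ∈ {0,…,ℓ^k - 1} with a (k+1) ≡ a k (mod ℓ^k).

record ℤ[_] (ℓ : ℕ) : Set where
  field
    res    : ℕ → ℕ
    bound  : ∀ k → res k < ℓ ^ k
    compat : ∀ k → res (suc k) ≡ res k [mod ℓ ^ k ]
open ℤ[_] public

-- Every point of ℙ²(ℚ_ℓ) has a representative (x:y:z) with
-- x,y,z ∈ ℤ_ℓ not all divisible by ℓ; the equation holds in
-- ℤ_ℓ = lim ℤ/ℓ^k iff it holds modulo ℓ^k for every k.
HasQℓPoint : (ℓ p a b c : ℕ) → Set
HasQℓPoint ℓ p a b c =
  Σ ℤ[ ℓ ] λ x → Σ ℤ[ ℓ ] λ y → Σ ℤ[ ℓ ] λ z →
    NonZeroTriple (res x 1) (res y 1) (res z 1) ×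
    (∀ k → (a * res x k ^ p + b * res y k ^ p + c * res z k ^ p) ≡ 0 [mod ℓ ^ k ])

-- Away from p, the curve X^p + q Y^p + r Z^p = 0 has a ℚ_ℓ-point as soon as it has a point modulo ℓ
-- at which some coordinate with a unit coefficient is a unit: Hensel's lemma lifts that coordinate.
-- For ℓ ∤ qr any point modulo ℓ will do, and one exists: otherwise ℓ is exceptional, hence ℓ ∣ r + 1,
-- and (1 : 0 : 1) is a point. For ℓ = r (resp. ℓ = q) we have p ∤ ℓ - 1, because r ≡ -1 (mod p) with
-- p ≥ 5 (resp. q ≢ 1 (mod p)), so by Fermat's little theorem every residue modulo ℓ is a p-th power, and
-- x^p ≡ -q (resp. x^p ≡ -r) gives the point (x : 1 : 0) (resp. (x : 0 : 1)). If q = r = ℓ, lift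
-- (0 : 1 : z) with z^p ≡ -1 instead.

module Submission where

open import Defs
open import Data.Fin.Base using (toℕ; fromℕ; inject₁) renaming (zero to fzero; suc to fsuc)
open import Data.Fin.Properties using (toℕ-fromℕ; toℕ-inject₁; toℕ<n)
open import Data.List.Base using (List; _∷_; [])
open import Data.List.Membership.Propositional using (_∈_)
open import Data.List.Relation.Unary.Unique.Propositional using (Unique)
open import Data.Nat.Base
open import Data.Nat.Combinatorics using (_C_; nCn≡1; nCk≡n!/k![n-k]!; k![n∸k]!∣n!)
open import Data.Nat.Coprimality using (Coprime; coprime-Bézout) renaming (sym to coprime-sym)
open import Data.Nat.DivMod
open import Data.Nat.Divisibility
open import Data.Nat.GCD using (module Bézout)
open import Data.Nat.ListAction using (product)
open import Data.Nat.ListAction.Properties using (∈⇒∣product)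
open import Data.Nat.Primality
open import Data.Nat.Properties
open import Data.Nat.Tactic.RingSolver using (solve)
open import Data.Product using (_×_; ∃; ∃₂; _,_; proj₁; proj₂)
open import Data.Sum using (_⊎_; inj₁; inj₂)
open import Data.Vec.Functional using (Vector; init; tail)
open import Function.Base using (_∘_)
open import Function.Bundles using (_⇔_; Equivalence)
open import Relation.Binary.PropositionalEquality
open import Relation.Nullary using (¬_; Dec; yes; no; contradiction; ¬?)
open import Relation.Nullary.Decidable using (map′; _×-dec_)

open import Algebra.Properties.CommutativeSemigroup +-commutativeSemigroup using (x∙yz≈y∙zx; xy∙z≈y∙xz)
open import Algebra.Properties.CommutativeSemiring.Binomial +-*-commutativeSemiring
  using (binomialTerm) renaming (theorem to binomial-theorem)
import Algebra.Properties.Monoid.Mult +-0-monoid as Mult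
import Algebra.Properties.Monoid.Sum +-0-monoid as Sum
import Algebra.Properties.Semiring.Exp +-*-semiring as Exp

open ≡-Reasoning

∤⇒nonZero : ∀ {d n} → d ∤ n → NonZero n
∤⇒nonZero {d} {zero} d∤0 = contradiction (d ∣0) d∤0
∤⇒nonZero {n = suc n} _ = _

prime⇒>1 : ∀ {p} → Prime p → 1 < p
prime⇒>1 {p} pp = nonTrivial⇒n>1 p {{prime⇒nonTrivial pp}}

prime∤1 : ∀ {p} → Prime p → p ∤ 1
prime∤1 pp = >⇒∤ (prime⇒>1 pp)

prime∤pred : ∀ {p} → Prime p → p ∤ p ∸ 1
prime∤pred {suc (suc p)} _ = >⇒∤ ≤-refl

prime∤⇒coprime : ∀ {p n} → Prime p → p ∤ n → Coprime p n
prime∤⇒coprime pp p∤n (d∣p , d∣n) with prime⇒irreducible pp d∣p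
... | inj₁ d≡1 = d≡1
... | inj₂ refl = contradiction d∣n p∤n

prime≢⇒∤ : ∀ {p q} → Prime p → Prime q → p ≢ q → p ∤ q
prime≢⇒∤ pp pq p≢q p∣q with prime⇒irreducible pq p∣q
... | inj₁ refl = ¬prime[1] pp
... | inj₂ p≡q = p≢q p≡q

∣⇒∣^ : ∀ {d x} n .{{_ : NonZero n}} → d ∣ x → d ∣ x ^ n
∣⇒∣^ {x = x} (suc n) d∣x = ∣m⇒∣m*n (x ^ n) d∣x

prime∣^⇒∣ : ∀ {p x} n → Prime p → p ∣ x ^ n → p ∣ x
prime∣^⇒∣ zero pp p∣1 = contradiction p∣1 (prime∤1 pp)
prime∣^⇒∣ {x = x} (suc n) pp p∣xⁿ⁺¹ with euclidsLemma x (x ^ n) pp p∣xⁿ⁺¹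
... | inj₁ p∣x = p∣x
... | inj₂ p∣xⁿ = prime∣^⇒∣ n pp p∣xⁿ

∣[n+1]⇒∤[n∸1] : ∀ {d n} → 2 < d → 0 < n → d ∣ n + 1 → d ∤ n ∸ 1
∣[n+1]⇒∤[n∸1] {d} {suc n} 2<d _ d∣n+2 d∣n =
  >⇒∤ 2<d (∣m+n∣m⇒∣n (subst (d ∣_) (trans (+-comm (suc n) 1) (+-comm 2 n)) d∣n+2) d∣n)

0^n≡0 : ∀ n .{{_ : NonZero n}} → 0 ^ n ≡ 0
0^n≡0 (suc n) = refl

≡[mod]-refl : ∀ {a m} → a ≡ a [mod m ]
≡[mod]-refl {a} = 0 , inj₁ (sym (+-identityʳ a))

≡[mod]⇒%≡ : ∀ {a b m} .{{_ : NonZero m}} → a ≡ b [mod m ] → a % m ≡ b % m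
≡[mod]⇒%≡ {b = b} {m} (k , inj₁ a≡b+km) = trans (cong (_% m) a≡b+km) ([m+kn]%n≡m%n b k m)
≡[mod]⇒%≡ {a} {m = m} (k , inj₂ b≡a+km) = sym (trans (cong (_% m) b≡a+km) ([m+kn]%n≡m%n a k m))

%≡⇒≡[mod] : ∀ {a b m} .{{_ : NonZero m}} → a % m ≡ b → a ≡ b [mod m ]
%≡⇒≡[mod] {a} {m = m} a%m≡b = a / m , inj₁ (trans (m≡m%n+[m/n]*n a m) (cong (_+ a / m * m) a%m≡b))

∣⇒≡0[mod] : ∀ {a m} → m ∣ a → a ≡ 0 [mod m ]
∣⇒≡0[mod] (divides k a≡km) = k , inj₁ a≡km

≡0[mod]⇒∣ : ∀ {a m} → a ≡ 0 [mod m ] → m ∣ a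
≡0[mod]⇒∣ (k , inj₁ a≡km) = divides k a≡km
≡0[mod]⇒∣ {a} {m} (k , inj₂ 0≡a+km) = subst (m ∣_) (sym (m+n≡0⇒m≡0 a (sym 0≡a+km))) (m ∣0)

≡0[mod]? : ∀ a m → Dec (a ≡ 0 [mod m ])
≡0[mod]? a m = map′ ∣⇒≡0[mod] ≡0[mod]⇒∣ (m ∣? a)

+-cong-mod : ∀ {m a a′ b b′} .{{_ : NonZero m}} →
             a % m ≡ a′ % m → b % m ≡ b′ % m → (a + b) % m ≡ (a′ + b′) % m
+-cong-mod {m} {a} {a′} {b} {b′} a≡a′ b≡b′ = begin
  (a + b) % m           ≡⟨ %-distribˡ-+ a b m ⟩
  (a % m + b % m) % m   ≡⟨ cong₂ (λ u v → (u + v) % m) a≡a′ b≡b′ ⟩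
  (a′ % m + b′ % m) % m ≡⟨ %-distribˡ-+ a′ b′ m ⟨
  (a′ + b′) % m         ∎

*-cong-mod : ∀ {m a a′ b b′} .{{_ : NonZero m}} →
             a % m ≡ a′ % m → b % m ≡ b′ % m → (a * b) % m ≡ (a′ * b′) % m
*-cong-mod {m} {a} {a′} {b} {b′} a≡a′ b≡b′ = begin
  (a * b) % m             ≡⟨ %-distribˡ-* a b m ⟩
  (a % m * (b % m)) % m   ≡⟨ cong₂ (λ u v → (u * v) % m) a≡a′ b≡b′ ⟩
  (a′ % m * (b′ % m)) % m ≡⟨ %-distribˡ-* a′ b′ m ⟨
  (a′ * b′) % m           ∎

^-cong-mod : ∀ {m a b} .{{_ : NonZero m}} → a % m ≡ b % m → ∀ n → a ^ n % m ≡ b ^ n % m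
^-cong-mod a≡b zero = refl
^-cong-mod a≡b (suc n) = *-cong-mod a≡b (^-cong-mod a≡b n)

-- Fermat's little theorem

×≡* : ∀ m x → m Mult.× x ≡ m * x
×≡* zero x = refl
×≡* (suc m) x = cong (x +_) (×≡* m x)

^-semiring≡^ : ∀ x n → x Exp.^ n ≡ x ^ n
^-semiring≡^ x zero = refl
^-semiring≡^ x (suc n) = cong (x *_) (^-semiring≡^ x n)

∣-sum : ∀ {d n} (t : Vector ℕ n) → (∀ i → d ∣ t i) → d ∣ Sum.sum t
∣-sum {n = zero} t d∣t = _ ∣0
∣-sum {n = suc n} t d∣t = ∣m∣n⇒∣m+n (d∣t fzero) (∣-sum (tail t) (d∣t ∘ fsuc))

nCk*k!*[n∸k]!≡n! : ∀ {n k} → k ≤ n → (n C k) * (k ! * (n ∸ k) !) ≡ n !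
nCk*k!*[n∸k]!≡n! {n} {k} k≤n =
  trans (cong (_* (k ! * (n ∸ k) !)) (nCk≡n!/k![n-k]! k≤n)) (m/n*n≡m (k![n∸k]!∣n! k≤n))
  where instance _ = k !* (n ∸ k) !≢0

prime∤m! : ∀ {p m} → Prime p → m < p → p ∤ m !
prime∤m! {m = zero} pp _ = prime∤1 pp
prime∤m! {m = suc m} pp m<p p∣m! with euclidsLemma (suc m) (m !) pp p∣m!
... | inj₁ p∣1+m = >⇒∤ m<p p∣1+m
... | inj₂ p∣m!′ = prime∤m! pp (<-trans (n<1+n m) m<p) p∣m!′

prime∣pCk : ∀ {p k} → Prime p → 0 < k → k < p → p ∣ p C k
prime∣pCk {p@(suc n)} {k} pp 0<k k<p
  with euclidsLemma (p C k) (k ! * (p ∸ k) !) pp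
         (subst (p ∣_) (sym (nCk*k!*[n∸k]!≡n! (<⇒≤ k<p))) (m∣m*n (n !)))
... | inj₁ p∣pCk = p∣pCk
... | inj₂ p∣k![p∸k]! with euclidsLemma (k !) ((p ∸ k) !) pp p∣k![p∸k]!
...   | inj₁ p∣k! = contradiction p∣k! (prime∤m! pp k<p)
...   | inj₂ p∣[p∸k]! = contradiction p∣[p∸k]! (prime∤m! pp (∸-monoʳ-< 0<k (<⇒≤ k<p)))

freshman's-dream : ∀ {p} .{{_ : NonZero p}} → Prime p → ∀ x y → (x + y) ^ p % p ≡ (x ^ p + y ^ p) % p
freshman's-dream {p@(suc (suc _))} pp x y = begin
  (x + y) ^ p % p
    ≡⟨ cong (_% p) (trans (sym (^-semiring≡^ (x + y) p)) (binomial-theorem p x y)) ⟩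
  Sum.sum t % p                          ≡⟨ cong (_% p) (cong (t fzero +_) (Sum.sum-init-last (tail t))) ⟩
  (t fzero + (middle + t (fromℕ p))) % p ≡⟨ cong (_% p) (x∙yz≈y∙zx (t fzero) middle _) ⟩
  (middle + (t (fromℕ p) + t fzero)) % p ≡⟨ %-remove-+ˡ _ p∣middle ⟩
  (t (fromℕ p) + t fzero) % p            ≡⟨ cong₂ (λ u v → (u + v) % p) t-last t-first ⟩
  (x ^ p + y ^ p) % p                    ∎
  where
  t = binomialTerm x y p
  middle = Sum.sum (init (tail t))
  t-at : ∀ i → t i ≡ (p C toℕ i) * (x ^ toℕ i * y ^ (p ∸ toℕ i))
  t-at i = trans (×≡* (p C toℕ i) _)
    (cong ((p C toℕ i) *_) (cong₂ _*_ (^-semiring≡^ x (toℕ i)) (^-semiring≡^ y (p ∸ toℕ i))))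
  p∣middle : p ∣ middle
  p∣middle = ∣-sum (init (tail t)) λ i → subst (p ∣_) (sym (t-at (fsuc (inject₁ i))))
    (∣m⇒∣m*n _ (prime∣pCk pp z<s (subst (_< p) (sym (cong suc (toℕ-inject₁ i))) (s<s (toℕ<n i)))))
  t-first : t fzero ≡ y ^ p
  t-first = trans (t-at fzero) (trans (*-identityˡ _) (*-identityˡ _))
  t-last : t (fromℕ p) ≡ x ^ p
  t-last = begin
    t (fromℕ p)                     ≡⟨ t-at (fromℕ p) ⟩
    _                               ≡⟨ cong (λ k → (p C k) * (x ^ k * y ^ (p ∸ k))) (toℕ-fromℕ p) ⟩
    (p C p) * (x ^ p * y ^ (p ∸ p)) ≡⟨ cong₂ (λ c e → c * (x ^ p * y ^ e)) (nCn≡1 p) (n∸n≡0 p) ⟩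
    1 * (x ^ p * 1)                 ≡⟨ trans (*-identityˡ _) (*-identityʳ _) ⟩
    x ^ p                           ∎

fermat : ∀ {p} .{{_ : NonZero p}} → Prime p → ∀ x → x ^ p % p ≡ x % p
fermat {suc n} pp zero = refl
fermat {p} pp (suc x) = begin
  (1 + x) ^ p % p     ≡⟨ freshman's-dream pp 1 x ⟩
  (1 ^ p + x ^ p) % p ≡⟨ +-cong-mod (cong (_% p) (^-zeroˡ p)) (fermat pp x) ⟩
  (1 + x) % p         ∎

fermat-^ : ∀ {p} .{{_ : NonZero p}} → Prime p → ∀ x j → x ^ (1 + j * (p ∸ 1)) % p ≡ x % p
fermat-^ {p@(suc n)} pp x zero = cong (_% p) (*-identityʳ x)
fermat-^ {p@(suc n)} pp x (suc j) = begin
  x ^ (p + j * n) % p     ≡⟨ cong (_% p) (^-distribˡ-+-* x p (j * n)) ⟩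
  x ^ p * x ^ (j * n) % p ≡⟨ *-cong-mod {a = x ^ p} {x} {x ^ (j * n)} {x ^ (j * n)} (fermat pp x) refl ⟩
  x * x ^ (j * n) % p     ≡⟨ fermat-^ pp x j ⟩
  x % p                   ∎

-- Roots modulo a prime

∃-inverse-mod : ∀ {a m} .{{_ : NonZero a}} → Coprime a m → ∃₂ λ e j → e * a ≡ 1 + j * m
∃-inverse-mod {a} {m} a⊥m with coprime-Bézout a⊥m
... | Bézout.+- x y 1+ym≡xa = x , y , sym 1+ym≡xa
... | Bézout.-+ x y 1+xa≡ym = from-negative-inverse m a 1+xa≡ym
  where
  -- x a ≡ -1 (mod m), so -x ≡ (m - 1) x + m is an inverse of a.
  from-negative-inverse : ∀ m a .{{_ : NonZero a}} → 1 + x * a ≡ y * m → ∃₂ λ e j → e * a ≡ 1 + j * m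
  from-negative-inverse zero a eq = contradiction (trans eq (*-zeroʳ y)) λ ()
  from-negative-inverse (suc m) (suc a) eq = m * x + suc m , m * y + a , (begin
    (m * x + suc m) * suc a               ≡⟨ solve (m ∷ x ∷ a ∷ []) ⟩
    m * (1 + x * suc a) + (1 + a * suc m) ≡⟨ cong (λ v → m * v + (1 + a * suc m)) eq ⟩
    m * (y * suc m) + (1 + a * suc m)     ≡⟨ solve (m ∷ y ∷ a ∷ []) ⟩
    1 + (m * y + a) * suc m               ∎)

-- With e B ≡ 1, the solution is t = e A (m - 1) ≡ -e A.
∃-solution-linear-mod : ∀ {m B} .{{_ : NonZero m}} .{{_ : NonZero B}} → Coprime B m →
                        ∀ A → ∃ λ t → m ∣ A + B * t
∃-solution-linear-mod {suc m} {B} B⊥m A with ∃-inverse-mod B⊥m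
... | e , j , eB≡1+jm = e * A * m , divides (A + j * A * m) (begin
  A + B * (e * A * m)           ≡⟨ solve (A ∷ B ∷ e ∷ m ∷ []) ⟩
  A + e * B * (A * m)           ≡⟨ cong (λ v → A + v * (A * m)) eB≡1+jm ⟩
  A + (1 + j * suc m) * (A * m) ≡⟨ solve (A ∷ j ∷ m ∷ []) ⟩
  (A + j * A * m) * suc m       ∎)

^-surjective-mod : ∀ {ℓ n} .{{_ : NonZero ℓ}} .{{_ : NonZero n}} → Prime ℓ → Coprime n (ℓ ∸ 1) →
                   ∀ b → ∃ λ x → x ^ n % ℓ ≡ b % ℓ
^-surjective-mod {ℓ} {n} pℓ n⊥ℓ-1 b with ∃-inverse-mod n⊥ℓ-1
... | e , j , en≡1+j[ℓ-1] = b ^ e , (begin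
  (b ^ e) ^ n % ℓ           ≡⟨ cong (_% ℓ) (^-*-assoc b e n) ⟩
  b ^ (e * n) % ℓ           ≡⟨ cong (λ k → b ^ k % ℓ) en≡1+j[ℓ-1] ⟩
  b ^ (1 + j * (ℓ ∸ 1)) % ℓ ≡⟨ fermat-^ pℓ b j ⟩
  b % ℓ                     ∎)

∃-unit-root : ∀ {ℓ n a} .{{_ : NonZero ℓ}} .{{_ : NonZero n}} → Prime ℓ → Coprime n (ℓ ∸ 1) →
              ℓ ∤ a → ∃ λ x → ℓ ∤ x × ℓ ∣ x ^ n + a
∃-unit-root {ℓ} {n} {a} pℓ n⊥ℓ-1 ℓ∤a with ^-surjective-mod pℓ n⊥ℓ-1 ((ℓ ∸ 1) * a)
... | x , xⁿ≡-a = x , ℓ∤x , m%n≡0⇒n∣m (x ^ n + a) ℓ (begin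
  (x ^ n + a) % ℓ       ≡⟨ +-cong-mod xⁿ≡-a refl ⟩
  ((ℓ ∸ 1) * a + a) % ℓ ≡⟨ cong (_% ℓ) (trans (+-comm _ a) (cong (_* a) (m+[n∸m]≡n (>-nonZero⁻¹ ℓ)))) ⟩
  (ℓ * a) % ℓ           ≡⟨ n∣m⇒m%n≡0 (ℓ * a) ℓ (m∣m*n a) ⟩
  0                     ∎)
  where
  ℓ∤x : ℓ ∤ x
  ℓ∤x ℓ∣x with euclidsLemma (ℓ ∸ 1) a pℓ
                 (m%n≡0⇒n∣m _ ℓ (trans (sym xⁿ≡-a) (n∣m⇒m%n≡0 _ ℓ (∣⇒∣^ n ℓ∣x))))
  ... | inj₁ ℓ∣ℓ-1 = prime∤pred pℓ ℓ∣ℓ-1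
  ... | inj₂ ℓ∣a = ℓ∤a ℓ∣a

-- Hensel's lemma

^-taylor : ∀ x h n → ∃ λ R → (x + h) ^ suc n ≡ x ^ suc n + suc n * x ^ n * h + h * h * R
^-taylor x h zero = 0 , linear
  where
  linear : (x + h) * 1 ≡ x * 1 + 1 * 1 * h + h * h * 0
  linear = solve (x ∷ h ∷ [])
^-taylor x h (suc n) with ^-taylor x h n
... | R , eq = x * R + suc n * x ^ n + h * R , trans (cong ((x + h) *_) eq) (expand (x ^ n))
  where
  expand : ∀ X → (x + h) * (x * X + suc n * X * h + h * h * R)
                 ≡ x * (x * X) + suc (suc n) * (x * X) * h + h * h * (x * R + suc n * X + h * R)
  expand X = solve (x ∷ h ∷ n ∷ R ∷ X ∷ [])

Coherent : ℕ → (ℕ → ℕ) → Set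
Coherent ℓ f = ∀ k → f (suc k) ≡ f k [mod ℓ ^ k ]

const-coherent : ∀ {ℓ} x → Coherent ℓ (λ _ → x)
const-coherent x k = ≡[mod]-refl

module HenselStep {ℓ u c n : ℕ} (pℓ : Prime ℓ) (ℓ∤u : ℓ ∤ u) (ℓ∤1+n : ℓ ∤ suc n) where

  Approximation : ℕ → Set
  Approximation m = ∃ λ x → ℓ ∤ x × ℓ ^ m ∣ u * x ^ suc n + c

  step : ∀ {m} .{{_ : NonZero m}} (a : Approximation m) →
         ∃ λ (a′ : Approximation (suc m)) → proj₁ a′ ≡ proj₁ a [mod ℓ ^ m ]
  step {m} (x , ℓ∤x , divides A uxⁿ⁺¹+c≡Aℓᵐ) = (x + t * M , ℓ∤x′ , ℓᵐ⁺¹∣) , t , inj₁ refl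
    where
    M = ℓ ^ m
    B = u * suc n * x ^ n
    ℓ∣M : ℓ ∣ M
    ℓ∣M = ∣⇒∣^ m ∣-refl
    ℓ∤B : ℓ ∤ B
    ℓ∤B ℓ∣B with euclidsLemma (u * suc n) (x ^ n) pℓ ℓ∣B
    ... | inj₂ ℓ∣xⁿ = ℓ∤x (prime∣^⇒∣ n pℓ ℓ∣xⁿ)
    ... | inj₁ ℓ∣u*[1+n] with euclidsLemma u (suc n) pℓ ℓ∣u*[1+n]
    ...   | inj₁ ℓ∣u = ℓ∤u ℓ∣u
    ...   | inj₂ ℓ∣1+n = ℓ∤1+n ℓ∣1+n
    correction : ∃ λ t → ℓ ∣ A + B * t
    correction = ∃-solution-linear-mod {{prime⇒nonZero pℓ}} {{∤⇒nonZero ℓ∤B}}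
                   (coprime-sym (prime∤⇒coprime pℓ ℓ∤B)) A
    t = proj₁ correction
    R = proj₁ (^-taylor x (t * M) n)
    -- Only the linear term of the Taylor expansion survives modulo ℓ^(m+1).
    expansion : u * (x + t * M) ^ suc n + c ≡ M * (A + B * t) + M * M * (u * t * t * R)
    expansion = begin
      u * (x + t * M) ^ suc n + c
        ≡⟨ cong (λ v → u * v + c) (proj₂ (^-taylor x (t * M) n)) ⟩
      u * (x ^ suc n + suc n * x ^ n * (t * M) + (t * M) * (t * M) * R) + c
        ≡⟨ regroup u n (x ^ suc n) (x ^ n) t M R c ⟩
      (u * x ^ suc n + c) + M * (B * t) + M * M * (u * t * t * R)
        ≡⟨ cong (λ v → v + M * (B * t) + M * M * (u * t * t * R)) uxⁿ⁺¹+c≡Aℓᵐ ⟩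
      A * M + M * (B * t) + M * M * (u * t * t * R)
        ≡⟨ factor A M (B * t) (M * M * (u * t * t * R)) ⟩
      M * (A + B * t) + M * M * (u * t * t * R) ∎
      where
      factor : ∀ A M D K → A * M + M * D + K ≡ M * (A + D) + K
      factor A M D K = solve (A ∷ M ∷ D ∷ K ∷ [])
      regroup : ∀ u n X Y t M R c → u * (X + suc n * Y * (t * M) + (t * M) * (t * M) * R) + c
                ≡ (u * X + c) + M * (u * suc n * Y * t) + M * M * (u * t * t * R)
      regroup u n X Y t M R c = solve (u ∷ n ∷ X ∷ Y ∷ t ∷ M ∷ R ∷ c ∷ [])
    ℓᵐ⁺¹∣ : ℓ ^ suc m ∣ u * (x + t * M) ^ suc n + c
    ℓᵐ⁺¹∣ = subst (ℓ ^ suc m ∣_) (sym expansion) (∣m∣n⇒∣m+n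
      (subst (_∣ M * (A + B * t)) (*-comm M ℓ) (*-monoʳ-∣ M (proj₂ correction)))
      (∣m⇒∣m*n (u * t * t * R) (*-monoˡ-∣ M ℓ∣M)))
    ℓ∤x′ : ℓ ∤ x + t * M
    ℓ∤x′ ℓ∣x′ = ℓ∤x (∣m+n∣m⇒∣n (subst (ℓ ∣_) (+-comm x (t * M)) ℓ∣x′) (∣n⇒∣m*n t ℓ∣M))

hensel : ∀ {ℓ u c n x₀} → Prime ℓ → ℓ ∤ u → ℓ ∤ n → ℓ ∤ x₀ → ℓ ∣ u * x₀ ^ n + c →
         ∃ λ f → Coherent ℓ f × ℓ ∤ f 1 × ∀ k → ℓ ^ k ∣ u * f k ^ n + c
hensel {n = zero} _ _ ℓ∤0 = contradiction (_ ∣0) ℓ∤0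
hensel {ℓ} {u} {c} {suc n} {x₀} pℓ ℓ∤u ℓ∤1+n ℓ∤x₀ ℓ∣ux₀ⁿ+c = f , coherent , ℓ∤x₀ , ℓᵏ∣
  where
  open HenselStep pℓ ℓ∤u ℓ∤1+n
  approximation : ∀ k → Approximation (suc k)
  approximation zero = x₀ , ℓ∤x₀ , subst (_∣ u * x₀ ^ suc n + c) (sym (*-identityʳ ℓ)) ℓ∣ux₀ⁿ+c
  approximation (suc k) = proj₁ (step {suc k} (approximation k))
  f : ℕ → ℕ
  f zero = x₀
  f (suc k) = proj₁ (approximation k)
  coherent : Coherent ℓ f
  coherent zero = ≡[mod]-refl
  coherent (suc k) = proj₂ (step {suc k} (approximation k))
  ℓᵏ∣ : ∀ k → ℓ ^ k ∣ u * f k ^ suc n + c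
  ℓᵏ∣ zero = 1∣ _
  ℓᵏ∣ (suc k) = proj₂ (proj₂ (approximation k))

-- ℓ-adic points

diagonalForm : (p a b c x y z : ℕ) → ℕ
diagonalForm p a b c x y z = a * x ^ p + b * y ^ p + c * z ^ p

diagonalForm-cong-mod : ∀ {m} .{{_ : NonZero m}} p {a a′ b b′ c c′ x x′ y y′ z z′} →
  a % m ≡ a′ % m → b % m ≡ b′ % m → c % m ≡ c′ % m → x % m ≡ x′ % m → y % m ≡ y′ % m → z % m ≡ z′ % m →
  diagonalForm p a b c x y z % m ≡ diagonalForm p a′ b′ c′ x′ y′ z′ % m
diagonalForm-cong-mod p a≡ b≡ c≡ x≡ y≡ z≡ =
  +-cong-mod (+-cong-mod (*-cong-mod a≡ (^-cong-mod x≡ p)) (*-cong-mod b≡ (^-cong-mod y≡ p)))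
             (*-cong-mod c≡ (^-cong-mod z≡ p))

diagonalForm-%-variables : ∀ {m} .{{_ : NonZero m}} p a b c x y z →
  diagonalForm p a b c (x % m) (y % m) (z % m) % m ≡ diagonalForm p a b c x y z % m
diagonalForm-%-variables {m} p a b c x y z = diagonalForm-cong-mod p {a} {a} {b} {b} {c} {c}
  refl refl refl (m%n%n≡m%n x m) (m%n%n≡m%n y m) (m%n%n≡m%n z m)

diagonalForm-%-coefficients : ∀ {m} .{{_ : NonZero m}} p a b c x y z →
  diagonalForm p a (b % m) (c % m) x y z % m ≡ diagonalForm p a b c x y z % m
diagonalForm-%-coefficients {m} p a b c x y z = diagonalForm-cong-mod p {a} {a} {x = x} {x} {y} {y} {z} {z}
  refl (m%n%n≡m%n b m) (m%n%n≡m%n c m) refl refl refl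

module _ {ℓ} .{{_ : NonZero ℓ}} where

  limit : (f : ℕ → ℕ) → Coherent ℓ f → ℤ[ ℓ ]
  limit f coherent = record { res = residue ; bound = residue<ℓ^k ; compat = residue-compat }
    where
    residue : ℕ → ℕ
    residue k = f k % ℓ ^ k
      where instance _ = m^n≢0 ℓ k
    residue<ℓ^k : ∀ k → residue k < ℓ ^ k
    residue<ℓ^k k = m%n<n (f k) (ℓ ^ k)
      where instance _ = m^n≢0 ℓ k
    residue-compat : ∀ k → residue (suc k) ≡ residue k [mod ℓ ^ k ]
    residue-compat k = %≡⇒≡[mod] (begin
      f (suc k) % ℓ ^ suc k % ℓ ^ k ≡⟨ m∣n⇒o%n%m≡o%m (ℓ ^ k) (ℓ ^ suc k) (f (suc k)) (n∣m*n ℓ) ⟩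
      f (suc k) % ℓ ^ k             ≡⟨ ≡[mod]⇒%≡ (coherent k) ⟩
      f k % ℓ ^ k                   ∎)
      where instance
        _ = m^n≢0 ℓ k
        _ = m^n≢0 ℓ (suc k)

  ℓ-adic-point : ∀ {p a b c fx fy fz} → Coherent ℓ fx → Coherent ℓ fy → Coherent ℓ fz →
                 ℓ ∤ fx 1 ⊎ ℓ ∤ fy 1 ⊎ ℓ ∤ fz 1 →
                 (∀ k → ℓ ^ k ∣ diagonalForm p a b c (fx k) (fy k) (fz k)) →
                 HasQℓPoint ℓ p a b c
  ℓ-adic-point {p} {a} {b} {c} {fx} {fy} {fz} cx cy cz unit ℓᵏ∣F =
    x , y , z , nonzero unit , solution
    where
    x = limit fx cx
    y = limit fy cy
    z = limit fz cz
    instance _ = m^n≢0 ℓ 1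
    ℓ∣ : ∀ {g} → g % ℓ ^ 1 ≡ 0 → ℓ ∣ g
    ℓ∣ {g} g%ℓ≡0 = ∣-trans (m∣m*n 1) (m%n≡0⇒n∣m g (ℓ ^ 1) g%ℓ≡0)
    nonzero : ℓ ∤ fx 1 ⊎ ℓ ∤ fy 1 ⊎ ℓ ∤ fz 1 → NonZeroTriple (res x 1) (res y 1) (res z 1)
    nonzero (inj₁ ℓ∤x) (x≡0 , _ , _) = ℓ∤x (ℓ∣ x≡0)
    nonzero (inj₂ (inj₁ ℓ∤y)) (_ , y≡0 , _) = ℓ∤y (ℓ∣ y≡0)
    nonzero (inj₂ (inj₂ ℓ∤z)) (_ , _ , z≡0) = ℓ∤z (ℓ∣ z≡0)
    solution : ∀ k → diagonalForm p a b c (res x k) (res y k) (res z k) ≡ 0 [mod ℓ ^ k ]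
    solution k = %≡⇒≡[mod] (trans
      (diagonalForm-%-variables {ℓ ^ k} p a b c (fx k) (fy k) (fz k))
      (n∣m⇒m%n≡0 _ _ (ℓᵏ∣F k)))
      where instance _ = m^n≢0 ℓ k

module _ {ℓ p} (pℓ : Prime ℓ) (ℓ∤p : ℓ ∤ p) where

  private instance
    ℓ≢0 = prime⇒nonZero pℓ

  lift-x : ∀ {a b c x y z} → ℓ ∤ a → ℓ ∤ x → ℓ ∣ diagonalForm p a b c x y z → HasQℓPoint ℓ p a b c
  lift-x {a} {b} {c} {x} {y} {z} ℓ∤a ℓ∤x ℓ∣F
    with hensel pℓ ℓ∤a ℓ∤p ℓ∤x (subst (ℓ ∣_) (+-assoc (a * x ^ p) _ _) ℓ∣F)
  ... | f , coherent , ℓ∤f1 , ℓᵏ∣ =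
    ℓ-adic-point {p = p} {a} {b} {c} coherent (const-coherent y) (const-coherent z) (inj₁ ℓ∤f1)
      λ k → subst (ℓ ^ k ∣_) (sym (+-assoc (a * f k ^ p) _ _)) (ℓᵏ∣ k)

  lift-y : ∀ {a b c x y z} → ℓ ∤ b → ℓ ∤ y → ℓ ∣ diagonalForm p a b c x y z → HasQℓPoint ℓ p a b c
  lift-y {a} {b} {c} {x} {y} {z} ℓ∤b ℓ∤y ℓ∣F
    with hensel pℓ ℓ∤b ℓ∤p ℓ∤y (subst (ℓ ∣_) (xy∙z≈y∙xz (a * x ^ p) _ _) ℓ∣F)
  ... | f , coherent , ℓ∤f1 , ℓᵏ∣ =
    ℓ-adic-point {p = p} {a} {b} {c} (const-coherent x) coherent (const-coherent z) (inj₂ (inj₁ ℓ∤f1))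
      λ k → subst (ℓ ^ k ∣_) (sym (xy∙z≈y∙xz (a * x ^ p) _ _)) (ℓᵏ∣ k)

  lift-z : ∀ {a b c x y z} → ℓ ∤ c → ℓ ∤ z → ℓ ∣ diagonalForm p a b c x y z → HasQℓPoint ℓ p a b c
  lift-z {a} {b} {c} {x} {y} {z} ℓ∤c ℓ∤z ℓ∣F
    with hensel pℓ ℓ∤c ℓ∤p ℓ∤z (subst (ℓ ∣_) (+-comm (a * x ^ p + b * y ^ p) _) ℓ∣F)
  ... | f , coherent , ℓ∤f1 , ℓᵏ∣ =
    ℓ-adic-point {p = p} {a} {b} {c} (const-coherent x) (const-coherent y) coherent (inj₂ (inj₂ ℓ∤f1))
      λ k → subst (ℓ ^ k ∣_) (+-comm _ (a * x ^ p + b * y ^ p)) (ℓᵏ∣ k)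

  HasFℓPoint⇒HasQℓPoint : ∀ {a b c} → ℓ ∤ a → ℓ ∤ b → ℓ ∤ c → HasFℓPoint p ℓ a b c → HasQℓPoint ℓ p a b c
  HasFℓPoint⇒HasQℓPoint {a} {b} {c} ℓ∤a ℓ∤b ℓ∤c (x , y , z , x<ℓ , y<ℓ , z<ℓ , nonzero , F≡0)
    with x ≟ 0 | y ≟ 0 | z ≟ 0
  ... | no x≢0 | _ | _ = lift-x {a} {b} {c} {x} {y} {z} ℓ∤a (>⇒∤ {{≢-nonZero x≢0}} x<ℓ) (≡0[mod]⇒∣ F≡0)
  ... | yes _ | no y≢0 | _ = lift-y {a} {b} {c} {x} {y} {z} ℓ∤b (>⇒∤ {{≢-nonZero y≢0}} y<ℓ) (≡0[mod]⇒∣ F≡0)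
  ... | yes _ | yes _ | no z≢0 = lift-z {a} {b} {c} {x} {y} {z} ℓ∤c (>⇒∤ {{≢-nonZero z≢0}} z<ℓ) (≡0[mod]⇒∣ F≡0)
  ... | yes x≡0 | yes y≡0 | yes z≡0 = contradiction (x≡0 , y≡0 , z≡0) nonzero

  module _ (p⊥ℓ-1 : Coprime p (ℓ ∸ 1)) where

    private instance
      p≢0 = ∤⇒nonZero ℓ∤p

    ∤b⇒HasQℓPoint : ∀ {b c} → ℓ ∤ b → HasQℓPoint ℓ p 1 b c
    ∤b⇒HasQℓPoint {b} {c} ℓ∤b with ∃-unit-root pℓ p⊥ℓ-1 ℓ∤b
    ... | x , ℓ∤x , ℓ∣xᵖ+b = lift-x {1} {b} {c} {x} {1} {0} (prime∤1 pℓ) ℓ∤x (subst (ℓ ∣_) eq ℓ∣xᵖ+b)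
      where
      shape : ∀ X b c → X + b ≡ 1 * X + b * 1 + c * 0
      shape X b c = solve (X ∷ b ∷ c ∷ [])
      eq : x ^ p + b ≡ diagonalForm p 1 b c x 1 0
      eq rewrite ^-zeroˡ p | 0^n≡0 p {{p≢0}} = shape (x ^ p) b c

    ∤c⇒HasQℓPoint : ∀ {b c} → ℓ ∤ c → HasQℓPoint ℓ p 1 b c
    ∤c⇒HasQℓPoint {b} {c} ℓ∤c with ∃-unit-root pℓ p⊥ℓ-1 ℓ∤c
    ... | x , ℓ∤x , ℓ∣xᵖ+c = lift-x {1} {b} {c} {x} {0} {1} (prime∤1 pℓ) ℓ∤x (subst (ℓ ∣_) eq ℓ∣xᵖ+c)
      where
      shape : ∀ X b c → X + c ≡ 1 * X + b * 0 + c * 1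
      shape X b c = solve (X ∷ b ∷ c ∷ [])
      eq : x ^ p + c ≡ diagonalForm p 1 b c x 0 1
      eq rewrite ^-zeroˡ p | 0^n≡0 p {{p≢0}} = shape (x ^ p) b c

    -- ℓ divides both coefficients, so lift-z does not apply; lift a root of Z^p + 1 instead.
    HasQℓPoint-ℓℓ : HasQℓPoint ℓ p 1 ℓ ℓ
    HasQℓPoint-ℓℓ with ∃-unit-root pℓ p⊥ℓ-1 (prime∤1 pℓ)
    ... | z₀ , ℓ∤z₀ , ℓ∣z₀ᵖ+1
      with hensel pℓ (prime∤1 pℓ) ℓ∤p ℓ∤z₀ (subst (ℓ ∣_) (cong (_+ 1) (sym (*-identityˡ (z₀ ^ p)))) ℓ∣z₀ᵖ+1)
    ... | f , coherent , ℓ∤f1 , ℓᵏ∣ =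
      ℓ-adic-point {p = p} {1} {ℓ} {ℓ} (const-coherent 0) (const-coherent 1) coherent (inj₂ (inj₂ ℓ∤f1))
        λ k → subst (ℓ ^ k ∣_) (eq (f k)) (∣n⇒∣m*n ℓ (ℓᵏ∣ k))
      where
      shape : ∀ ℓ Z → ℓ * (1 * Z + 1) ≡ 1 * 0 + ℓ * 1 + ℓ * Z
      shape ℓ Z = solve (ℓ ∷ Z ∷ [])
      eq : ∀ z → ℓ * (1 * z ^ p + 1) ≡ diagonalForm p 1 ℓ ℓ 0 1 z
      eq z rewrite ^-zeroˡ p | 0^n≡0 p {{p≢0}} = shape ℓ (z ^ p)

HasFℓPoint? : ∀ p ℓ u v w → Dec (HasFℓPoint p ℓ u v w)
HasFℓPoint? p ℓ u v w = map′
  (λ (x , x<ℓ , y , y<ℓ , z , z<ℓ , point) → x , y , z , x<ℓ , y<ℓ , z<ℓ , point)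
  (λ (x , y , z , x<ℓ , y<ℓ , z<ℓ , point) → x , x<ℓ , y , y<ℓ , z , z<ℓ , point)
  (anyUpTo? (λ x → anyUpTo? (λ y → anyUpTo? (λ z →
     ¬? (x ≟ 0 ×-dec y ≟ 0 ×-dec z ≟ 0) ×-dec ≡0[mod]? (diagonalForm p u v w x y z) ℓ) ℓ) ℓ) ℓ)

HasFℓPoint-%-coefficients : ∀ {p ℓ a b c} .{{_ : NonZero ℓ}} →
                            HasFℓPoint p ℓ a (b % ℓ) (c % ℓ) → HasFℓPoint p ℓ a b c
HasFℓPoint-%-coefficients {p} {ℓ} {a} {b} {c} (x , y , z , x<ℓ , y<ℓ , z<ℓ , nonzero , F≡0) =
  x , y , z , x<ℓ , y<ℓ , z<ℓ , nonzero , %≡⇒≡[mod] (begin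
    diagonalForm p a b c x y z % ℓ             ≡⟨ diagonalForm-%-coefficients p a b c x y z ⟨
    diagonalForm p a (b % ℓ) (c % ℓ) x y z % ℓ ≡⟨ n∣m⇒m%n≡0 _ ℓ (≡0[mod]⇒∣ F≡0) ⟩
    0                                          ∎)

HasFℓPoint-1qr : ∀ {p ℓ q r} .{{_ : NonZero p}} .{{_ : NonZero ℓ}} → Prime ℓ → ℓ ∤ p → ℓ ∤ q → ℓ ∤ r →
                 (Exceptional p ℓ → ℓ ∣ r + 1) → HasFℓPoint p ℓ 1 q r
HasFℓPoint-1qr {p} {ℓ} {q} {r} {{p≢0}} pℓ ℓ∤p ℓ∤q ℓ∤r exceptional⇒ℓ∣r+1 with HasFℓPoint? p ℓ 1 (q % ℓ) (r % ℓ)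
... | yes point = HasFℓPoint-%-coefficients {p} {a = 1} point
... | no ¬point = 1 , 0 , 1 , 1<ℓ , >-nonZero⁻¹ ℓ , 1<ℓ , (λ ()) , ∣⇒≡0[mod] (subst (ℓ ∣_) eq ℓ∣r+1)
  where
  1<ℓ = prime⇒>1 pℓ
  %-unit : ∀ {a} → ℓ ∤ a → 0 < a % ℓ
  %-unit {a} ℓ∤a = n≢0⇒n>0 (ℓ∤a ∘ m%n≡0⇒n∣m a ℓ)
  ℓ∣r+1 : ℓ ∣ r + 1
  ℓ∣r+1 = exceptional⇒ℓ∣r+1 (pℓ , (λ ℓ≡p → ℓ∤p (subst (ℓ ∣_) ℓ≡p ∣-refl)) , 1 , q % ℓ , r % ℓ ,
    z<s , 1<ℓ , %-unit ℓ∤q , m%n<n q ℓ , %-unit ℓ∤r , m%n<n r ℓ , ¬point)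
  shape : ∀ q r → r + 1 ≡ 1 * 1 + q * 0 + r * 1
  shape q r = solve (q ∷ r ∷ [])
  eq : r + 1 ≡ diagonalForm p 1 q r 1 0 1
  eq rewrite ^-zeroˡ p | 0^n≡0 p {{p≢0}} = shape q r

HasQℓPoint-1qr : ∀ {ℓ p q r} → Prime ℓ → ℓ ∤ p → Prime q → Prime r → Coprime p (q ∸ 1) → Coprime p (r ∸ 1) →
                 (Exceptional p ℓ → ℓ ∣ r + 1) → HasQℓPoint ℓ p 1 q r
HasQℓPoint-1qr {ℓ} {p} {q} {r} pℓ ℓ∤p pq pr p⊥q-1 p⊥r-1 exceptional⇒ℓ∣r+1 with ℓ ≟ r | ℓ ≟ q
... | yes refl | yes refl = HasQℓPoint-ℓℓ pℓ ℓ∤p p⊥r-1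
... | yes refl | no ℓ≢q   = ∤b⇒HasQℓPoint pℓ ℓ∤p p⊥r-1 {c = ℓ} (prime≢⇒∤ pℓ pq ℓ≢q)
... | no ℓ≢r   | yes refl = ∤c⇒HasQℓPoint pℓ ℓ∤p p⊥q-1 {b = ℓ} (prime≢⇒∤ pℓ pr ℓ≢r)
... | no ℓ≢r   | no ℓ≢q   = HasFℓPoint⇒HasQℓPoint pℓ ℓ∤p (prime∤1 pℓ) ℓ∤q ℓ∤r
  (HasFℓPoint-1qr {{∤⇒nonZero ℓ∤p}} {{prime⇒nonZero pℓ}} pℓ ℓ∤p ℓ∤q ℓ∤r exceptional⇒ℓ∣r+1)
  where
  ℓ∤q = prime≢⇒∤ pℓ pq ℓ≢q
  ℓ∤r = prime≢⇒∤ pℓ pr ℓ≢r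

mainTheorem3 : (p : ℕ) → Prime p → 5 ≤ p →
    (S : List ℕ) → Unique S → (∀ ℓ → (ℓ ∈ S) ⇔ Exceptional p ℓ) →
    (r : ℕ) → Prime r → (p * product S) ∣ (r + 1) →
    ¬ ((p ^ 2) ∣ (r ^ (p ∸ 1) ∸ 1)) →
    (q : ℕ) → Prime q → ¬ (q ≡ p) → ¬ (p ∣ (q ∸ 1)) →
    (ℓ : ℕ) → Prime ℓ → ¬ (ℓ ≡ p) →
    HasQℓPoint ℓ p 1 q r
mainTheorem3 p pp 5≤p S _ S⇔exceptional r pr pΠS∣r+1 _ q pq _ p∤q-1 ℓ pℓ ℓ≢p =
  HasQℓPoint-1qr pℓ (prime≢⇒∤ pℓ pp ℓ≢p) pq pr (prime∤⇒coprime pp p∤q-1) (prime∤⇒coprime pp p∤r-1)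
    exceptional⇒ℓ∣r+1
  where
  p∣r+1 : p ∣ r + 1
  p∣r+1 = ∣-trans (m∣m*n (product S)) pΠS∣r+1
  p∤r-1 : p ∤ r ∸ 1
  p∤r-1 = ∣[n+1]⇒∤[n∸1] (≤-trans (s≤s (s≤s (s≤s z≤n))) 5≤p) (<-trans z<s (prime⇒>1 pr)) p∣r+1
  exceptional⇒ℓ∣r+1 : Exceptional p ℓ → ℓ ∣ r + 1
  exceptional⇒ℓ∣r+1 e = ∣-trans (∈⇒∣product (Equivalence.from (S⇔exceptional ℓ) e)) (∣-trans (n∣m*n p) pΠS∣r+1)
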